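{- Let $G$ be a partially ordered group with identity $e$ and positive cone $G^+ = \{x\in G : x>e\}$. Let $\mathcal{J}$ be the set of all downward closed nonempty finite subsets of $G^+$, and for $A \subseteq G$ let $\sigma_{\mathcal{J}}(A) = \inf\{ |A\cap J|/|J| : J \in \mathcal{J}\}$. Let $h \ge 2$ and let $A_1, \dots, A_h$ be subsets of $G^+$ with $\sigma_{\mathcal{J}}(A_i) = \alpha_i$ for $i \in \{1,\dots,h\}$. Suppose that for every $J \in \mathcal{J}$, every $i \in \{1,\dots,h\}$ and every $x \in J \setminus A_i$, the set $A_i^*(x) = \{a \in A_i : a < x\} = A_i \cap (e,x)$ is nonempty and finite. Then \[ 1 - \sigma_{\mathcal{J}}(A_1\cdots A_h) \le \prod_{i=1}^h \bigl(1 - \sigma_{\mathcal{J}}(A_i)\bigr), \] where $A_1\cdots A_h = \{a_1\cdots a_h : a_i \in A_i \cup\{e\} \text{ for all } i\}$.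
   Context: A partially ordered group is a group $G$ with a partial order $\le$ such that $a \le b$ implies $ac \le bc$ and $ca \le cb$ for all $a,b,c \in G$. We write $x<y$ if $x \le y$ and $x\ne y$. For $x\in G$, $(e,x)=\{y\in G: e<y<x\}$. A subset $J \subseteq G^+$ is downward closed if $x \in J$ implies $(e,x) \subseteq J$. -}

module Defs where

open import Level using (Level)
open import Algebra.Bundles using (Group)
open import Relation.Binary.Core using (Rel)
open import Relation.Binary.Structures using (IsPartialOrder)
open import Relation.Unary using (Pred)
open import Relation.Nullary using (¬_; Dec; yes; no)
open import Axiom.ExcludedMiddle using (ExcludedMiddle)
open import Data.Nat using (ℕ; zero; suc)
open import Data.Fin using (Fin; zero; suc)
open import Data.List using (List; []; _∷_; length)
open import Data.List.Relation.Unary.Any using (Any)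
open import Data.List.Relation.Unary.AllPairs using (AllPairs)
open import Data.Product using (Σ; _×_; ∃)
open import Data.Sum using (_⊎_)
open import Data.Integer using (+_)
open import Data.Rational as ℚ using (ℚ; 1ℚ; _-_; _*_)
open import Data.Empty using (⊥)
open import Relation.Binary.PropositionalEquality using (_≡_)

record IsPOGroup {a : Level} (G : Group a a) (_≤_ : Rel (Group.Carrier G) a) : Set a where
  open Group G
  field
    isPartialOrder : IsPartialOrder _≈_ _≤_
    compatʳ : ∀ {x y} z → x ≤ y → (x ∙ z) ≤ (y ∙ z)
    compatˡ : ∀ {x y} z → x ≤ y → (z ∙ x) ≤ (z ∙ y)

module POGroup {a : Level} (G : Group a a) (_≤_ : Rel (Group.Carrier G) a) where
  open Group G

  _<_ : Rel Carrier a
  x < y = x ≤ y × ¬ (x ≈ y)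

  Subset : Set _
  Subset = Pred Carrier a

  Respects : Subset → Set a
  Respects A = ∀ {x y} → A x → x ≈ y → A y

  _∈L_ : Carrier → List Carrier → Set a
  x ∈L J = Any (x ≈_) J

  -- J is a downward closed nonempty finite subset of G⁺, given as a
  -- duplicate-free list
  record InJ (J : List Carrier) : Set a where
    field
      distinct    : AllPairs (λ x y → ¬ (x ≈ y)) J
      nonempty    : ¬ (J ≡ [])
      positive    : ∀ {x} → x ∈L J → ε < x
      downClosed  : ∀ {x y} → x ∈L J → ε < y → y < x → y ∈L J

  count : ExcludedMiddle a → Subset → List Carrier → ℕ
  count lem A [] = 0
  count lem A (x ∷ J) with lem {A x}
  ... | yes _ = suc (count lem A J)
  ... | no  _ = count lem A J

  size : List Carrier → ℚ
  size J = (+ length J) ℚ./ 1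

  -- q ≤ σ_𝒥(A), i.e. q ≤ |A ∩ J| / |J| for all J ∈ 𝒥
  LowerDensity : ExcludedMiddle a → ℚ → Subset → Set a
  LowerDensity lem q A = ∀ J → InJ J → q * size J ℚ.≤ ((+ count lem A J) ℚ./ 1)

  prodG : ∀ n → (Fin n → Carrier) → Carrier
  prodG zero    f = ε
  prodG (suc n) f = f zero ∙ prodG n (λ i → f (suc i))

  ProdSet : ∀ h → (Fin h → Subset) → Subset
  ProdSet h A x = Σ (Fin h → Carrier) λ f →
    (∀ i → A i (f i) ⊎ f i ≈ ε) × x ≈ prodG h f

  StarNonemptyFinite : Subset → Carrier → Set a
  StarNonemptyFinite A x =
    (∃ λ b → A b × b < x) ×
    (Σ (List Carrier) λ L → ∀ {b} → A b → b < x → b ∈L L)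

prodℚ : ∀ n → (Fin n → ℚ) → ℚ
prodℚ zero    f = 1ℚ
prodℚ (suc n) f = f zero * prodℚ n (λ i → f (suc i))

-- Schnirelmann's argument. Put B = A₂⋯A_h with density β and fix J ∈ 𝒥. A maximal
-- element m of A₁ ∩ J exists because every x ∈ J ∖ A₁ has an element of A₁ below it.
-- By maximality of m, the points of J ∖ A₁ above m, translated by m⁻¹, form a downward
-- closed subset of G⁺, so a β-fraction of them lies in m·B ⊆ A₁B ∖ A₁.
-- Removing m and these points from J leaves a smaller downward closed set, so induction
-- on |J| gives |(A₁B ∖ A₁) ∩ J| ≥ β |J ∖ A₁|. Adding |A₁ ∩ J| ≥ α₁ |J| yields
-- 1 − σ(A₁B) ≤ (1 − α₁)(1 − β), and induction on h finishes.
module Submission where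

open import Defs
open import Level using (Level)
open import Algebra.Bundles using (Group)
open import Relation.Binary.Core using (Rel)
open import Relation.Nullary using (¬_)
open import Axiom.ExcludedMiddle using (ExcludedMiddle)
open import Data.Nat using (ℕ; _≤_)
open import Data.Fin using (Fin)
open import Data.List using (List)
open import Data.Integer using (+_)
open import Data.Rational as ℚ using (ℚ; 1ℚ; _-_; _*_)

open import Data.Empty using (⊥-elim)
open import Data.Fin using (zero; suc)
import Data.Integer as ℤ
import Data.Integer.Properties as ℤₚ
open import Data.List using ([]; _∷_; length; map; filter)
open import Data.List.Membership.Setoid.Properties
  using (∈-resp-≈; ∈-filter⁺; ∈-filter⁻; ∈-map⁺; ∈-map⁻)
import Data.List.Properties as Listₚ
open import Data.List.Relation.Unary.AllPairs using (AllPairs)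
import Data.List.Relation.Unary.Any as Any
open import Data.List.Relation.Unary.Any using (here; there)
import Data.List.Relation.Unary.Unique.Setoid.Properties as Unique
open import Data.Nat as ℕ using (zero; suc; z≤n; s≤s)
import Data.Nat.Coprimality as Coprimality
open import Data.Nat.Induction using (<-wellFounded)
import Data.Nat.Properties as ℕₚ
open import Data.Product using (_×_; _,_; proj₁; proj₂; ∃)
open import Data.Rational using (0ℚ; _+_; mkℚ)
import Data.Rational.Properties as ℚₚ
open import Data.Rational.Solver using (module +-*-Solver)
open import Data.Sum using (inj₁; inj₂)
open import Function using (_∘_; _on_)
open import Induction.WellFounded using (Acc; acc)
import Relation.Binary.Construct.NonStrictToStrict as NonStrictToStrict
import Relation.Binary.Construct.On as On
open import Relation.Binary.PropositionalEquality
  using (_≡_; refl; sym; trans; cong; cong₂; subst; subst₂; module ≡-Reasoning)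
open import Relation.Binary.Structures using (IsStrictPartialOrder)
open import Relation.Nullary using (yes; no)
open import Relation.Unary using (_∩_; ∁; _⊆_; Decidable)

ι : ℕ → ℚ
ι n = + n ℚ./ 1

ι≡mkℚ : ∀ n → ι n ≡ mkℚ (+ n) 0 (Coprimality.sym (Coprimality.1-coprimeTo n))
ι≡mkℚ n = ℚₚ.normalize-coprime _

ι-+ : ∀ m n → ι (m ℕ.+ n) ≡ ι m + ι n
ι-+ m n = begin
  ι (m ℕ.+ n)                          ≡⟨ cong (ℚ._/ 1) numerators ⟩
  -- this fraction is what ℚ._+_ computes on mkℚ (+ m) 0 _ and mkℚ (+ n) 0 _
  (+ m ℤ.* + 1 ℤ.+ + n ℤ.* + 1) ℚ./ 1  ≡⟨ cong₂ _+_ (ι≡mkℚ m) (ι≡mkℚ n) ⟨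
  ι m + ι n                            ∎
  where
  open ≡-Reasoning
  numerators : + (m ℕ.+ n) ≡ + m ℤ.* + 1 ℤ.+ + n ℤ.* + 1
  numerators = sym (cong₂ ℤ._+_ (ℤₚ.*-identityʳ (+ m)) (ℤₚ.*-identityʳ (+ n)))

ι-mono : ∀ {m n} → m ℕ.≤ n → ι m ℚ.≤ ι n
ι-mono {m} {n} m≤n rewrite ι≡mkℚ m | ι≡mkℚ n =
  ℚ.*≤* (ℤₚ.*-monoʳ-≤-nonNeg (+ 1) (ℤ.+≤+ m≤n))

ι-nonNeg : ∀ n → 0ℚ ℚ.≤ ι n
ι-nonNeg n = ι-mono {0} {n} z≤n

ι-positive : ∀ {n} → 0 ℕ.< n → ℚ.Positive (ι n)
ι-positive {suc n} _ rewrite ι≡mkℚ (suc n) = _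

module _ where
  open ℚₚ.≤-Reasoning
  open +-*-Solver

  nonPos*ι≤ι : ∀ {β} m n → β ℚ.≤ 0ℚ → β * ι m ℚ.≤ ι n
  nonPos*ι≤ι {β} m n β≤0 = begin
    β * ι m    ≤⟨ ℚₚ.*-monoʳ-≤-nonNeg (ι m) {{ℚ.nonNegative (ι-nonNeg m)}} β≤0 ⟩
    0ℚ * ι m   ≡⟨ ℚₚ.*-zeroˡ (ι m) ⟩
    0ℚ         ≤⟨ ι-nonNeg n ⟩
    ι n        ∎

  *ι-zero≤ι : ∀ β n → β * ι 0 ℚ.≤ ι n
  *ι-zero≤ι β n = begin
    β * 0ℚ     ≡⟨ ℚₚ.*-zeroʳ β ⟩
    0ℚ         ≤⟨ ι-nonNeg n ⟩
    ι n        ∎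

  *ι-split : ∀ {β} {n d n′ k₁ k₂ k} → 0ℚ ℚ.≤ β → n ℕ.≤ d ℕ.+ n′ →
             β * ι d ℚ.≤ ι k₁ → β * ι n′ ℚ.≤ ι k₂ → k₁ ℕ.+ k₂ ℕ.≤ k →
             β * ι n ℚ.≤ ι k
  *ι-split {β} {n} {d} {n′} {k₁} {k₂} {k} 0≤β n≤d+n′ βd≤k₁ βn′≤k₂ k₁+k₂≤k = begin
    β * ι n                 ≤⟨ ℚₚ.*-monoˡ-≤-nonNeg β {{ℚ.nonNegative 0≤β}} (ι-mono n≤d+n′) ⟩
    β * ι (d ℕ.+ n′)        ≡⟨ cong (β *_) (ι-+ d n′) ⟩
    β * (ι d + ι n′)        ≡⟨ ℚₚ.*-distribˡ-+ β (ι d) (ι n′) ⟩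
    β * ι d + β * ι n′      ≤⟨ ℚₚ.+-mono-≤ βd≤k₁ βn′≤k₂ ⟩
    ι k₁ + ι k₂             ≡⟨ ι-+ k₁ k₂ ⟨
    ι (k₁ ℕ.+ k₂)           ≤⟨ ι-mono k₁+k₂≤k ⟩
    ι k                     ∎

  [1-p]n≤m≤n⇒0≤p : ∀ {P} m n → 0 ℕ.< n →
                   (1ℚ - P) * ι n ℚ.≤ ι m → m ℕ.≤ n → 0ℚ ℚ.≤ P
  [1-p]n≤m≤n⇒0≤p {P} m n 0<n density m≤n = begin
    0ℚ                ≡⟨ ℚₚ.+-inverseʳ 1ℚ ⟨
    1ℚ - 1ℚ           ≤⟨ ℚₚ.+-monoʳ-≤ 1ℚ (ℚₚ.neg-antimono-≤ 1-P≤1) ⟩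
    1ℚ - (1ℚ - P)     ≡⟨ solve 1 (λ P → con 1ℚ :- (con 1ℚ :- P) := P) refl P ⟩
    P                 ∎
    where
    1-P≤1 : 1ℚ - P ℚ.≤ 1ℚ
    1-P≤1 = ℚₚ.*-cancelʳ-≤-pos (ι n) {{ι-positive 0<n}} (begin
      (1ℚ - P) * ι n   ≤⟨ density ⟩
      ι m              ≤⟨ ι-mono m≤n ⟩
      ι n              ≡⟨ ℚₚ.*-identityˡ (ι n) ⟨
      1ℚ * ι n         ∎)

  density-combine : ∀ {α P} {N c c′ k} → 0ℚ ℚ.≤ P → N ≡ c ℕ.+ c′ →
                    α * ι N ℚ.≤ ι c → (1ℚ - P) * ι c′ ℚ.≤ ι k →
                    (1ℚ - (1ℚ - α) * P) * ι N ℚ.≤ ι (c ℕ.+ k)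
  density-combine {α} {P} {N} {c} {c′} {k} 0≤P refl αN≤c gap = begin
    (1ℚ - (1ℚ - α) * P) * ι N          ≡⟨ expand α P (ι N) ⟩
    P * (α * ι N) + (1ℚ - P) * ι N     ≤⟨ ℚₚ.+-monoˡ-≤ _ (ℚₚ.*-monoˡ-≤-nonNeg P {{ℚ.nonNegative 0≤P}} αN≤c) ⟩
    P * ι c + (1ℚ - P) * ι N           ≡⟨ cong (λ x → P * ι c + (1ℚ - P) * x) (ι-+ c c′) ⟩
    P * ι c + (1ℚ - P) * (ι c + ι c′)  ≡⟨ collect P (ι c) (ι c′) ⟩
    ι c + (1ℚ - P) * ι c′              ≤⟨ ℚₚ.+-monoʳ-≤ (ι c) gap ⟩
    ι c + ι k                          ≡⟨ ι-+ c k ⟨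
    ι (c ℕ.+ k)                        ∎
    where
    expand : ∀ α P N → (1ℚ - (1ℚ - α) * P) * N ≡ P * (α * N) + (1ℚ - P) * N
    expand = solve 3 (λ α P N → (con 1ℚ :- (con 1ℚ :- α) :* P) :* N
                                  := P :* (α :* N) :+ (con 1ℚ :- P) :* N) refl
    collect : ∀ P C C′ → P * C + (1ℚ - P) * (C + C′) ≡ C + (1ℚ - P) * C′
    collect = solve 3 (λ P C C′ → P :* C :+ (con 1ℚ :- P) :* (C :+ C′)
                                   := C :+ (con 1ℚ :- P) :* C′) refl

module _ {a : Level} (lem : ExcludedMiddle a) (G : Group a a) (_≼_ : Rel (Group.Carrier G) a)
         (po : IsPOGroup G _≼_) where

  open Group G
    using (Carrier; _≈_; _∙_; ε; _⁻¹; _\\_; setoid; ∙-congˡ; identityˡ; identityʳ; inverseˡ)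
    renaming (refl to ≈-refl; sym to ≈-sym; trans to ≈-trans)
  open POGroup G _≼_
  open IsPOGroup po
  open IsStrictPartialOrder (NonStrictToStrict.<-isStrictPartialOrder _≈_ _≼_ isPartialOrder)
    using ()
    renaming (irrefl to <-irrefl; trans to <-trans; <-respʳ-≈ to <-respʳ; <-respˡ-≈ to <-respˡ)
  open import Algebra.Properties.Group G using (∙-cancelˡ; \\-leftDividesˡ; \\-leftDividesʳ)

  <-compatˡ : ∀ {x y} z → x < y → (z ∙ x) < (z ∙ y)
  <-compatˡ {x} {y} z (x≼y , x≉y) = compatˡ z x≼y , λ zx≈zy → x≉y (∙-cancelˡ z x y zx≈zy)

  ε<⇒<∙ : ∀ {u z} → ε < z → u < (u ∙ z)
  ε<⇒<∙ {u} ε<z = <-respˡ (identityʳ u) (<-compatˡ u ε<z)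

  <⇒ε<\\ : ∀ {u x} → u < x → ε < (u \\ x)
  <⇒ε<\\ {u} u<x = <-respˡ (inverseˡ u) (<-compatˡ (u ⁻¹) u<x)

  _·_ : Subset → Subset → Subset
  (A · B) x = ∃ λ u → ∃ λ v → A u × B v × x ≈ (u ∙ v)

  decide : (P : Subset) → Decidable P
  decide P x = lem

  count-mono : ∀ {P Q : Subset} → P ⊆ Q → ∀ L → count lem P L ℕ.≤ count lem Q L
  count-mono P⊆Q [] = z≤n
  count-mono {P} {Q} P⊆Q (x ∷ L) with lem {P x} | lem {Q x}
  ... | yes _  | yes _  = s≤s (count-mono P⊆Q L)
  ... | yes Px | no ¬Qx = ⊥-elim (¬Qx (P⊆Q Px))
  ... | no _   | yes _  = ℕₚ.m≤n⇒m≤1+n (count-mono P⊆Q L)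
  ... | no _   | no _   = count-mono P⊆Q L

  count-split : ∀ (P Q : Subset) L →
                count lem P L ≡ count lem (P ∩ Q) L ℕ.+ count lem (P ∩ ∁ Q) L
  count-split P Q [] = refl
  count-split P Q (x ∷ L) with lem {P x} | lem {Q x}
  count-split P Q (x ∷ L) | yes Px | yes Qx with lem {P x × Q x} | lem {P x × ¬ Q x}
  ... | yes _ | no _  = cong suc (count-split P Q L)
  ... | no ¬PQ | _    = ⊥-elim (¬PQ (Px , Qx))
  ... | _ | yes (_ , ¬Qx) = ⊥-elim (¬Qx Qx)
  count-split P Q (x ∷ L) | yes Px | no ¬Qx with lem {P x × Q x} | lem {P x × ¬ Q x}
  ... | no _ | yes _  = trans (cong suc (count-split P Q L)) (sym (ℕₚ.+-suc _ _))
  ... | yes (_ , Qx) | _ = ⊥-elim (¬Qx Qx)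
  ... | _ | no ¬P¬Q   = ⊥-elim (¬P¬Q (Px , ¬Qx))
  count-split P Q (x ∷ L) | no ¬Px | _ with lem {P x × Q x} | lem {P x × ¬ Q x}
  ... | no _ | no _   = count-split P Q L
  ... | yes (Px , _) | _ = ⊥-elim (¬Px Px)
  ... | _ | yes (Px , _) = ⊥-elim (¬Px Px)

  count-complement : ∀ (P : Subset) L → count lem P L ℕ.+ count lem (∁ P) L ≡ length L
  count-complement P [] = refl
  count-complement P (x ∷ L) with lem {P x} | lem {¬ P x}
  ... | yes _  | no _    = cong suc (count-complement P L)
  ... | no _   | yes _   = trans (ℕₚ.+-suc _ _) (cong suc (count-complement P L))
  ... | yes Px | yes ¬Px = ⊥-elim (¬Px Px)
  ... | no ¬Px | no ¬¬Px = ⊥-elim (¬¬Px ¬Px)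

  count-≤-length : ∀ (P : Subset) L → count lem P L ℕ.≤ length L
  count-≤-length P L = subst (count lem P L ℕ.≤_) (count-complement P L) (ℕₚ.m≤m+n _ _)

  count-none : ∀ (P : Subset) L → (∀ {x} → x ∈L L → ¬ P x) → count lem P L ≡ 0
  count-none P [] _ = refl
  count-none P (x ∷ L) none with lem {P x}
  ... | yes Px = ⊥-elim (none (here ≈-refl) Px)
  ... | no _   = count-none P L (none ∘ there)

  length-filter≡count : ∀ (P : Subset) L → length (filter (decide P) L) ≡ count lem P L
  length-filter≡count P [] = refl
  length-filter≡count P (x ∷ L) with lem {P x}
  ... | yes _ = cong suc (length-filter≡count P L)
  ... | no _  = length-filter≡count P L

  count-filter : ∀ (Q P : Subset) L → count lem Q (filter (decide P) L) ≡ count lem (Q ∩ P) L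
  count-filter Q P [] = refl
  count-filter Q P (x ∷ L) with lem {P x}
  count-filter Q P (x ∷ L) | yes Px with lem {Q x} | lem {Q x × P x}
  ... | yes _  | yes _        = cong suc (count-filter Q P L)
  ... | no _   | no _         = count-filter Q P L
  ... | yes Qx | no ¬QP       = ⊥-elim (¬QP (Qx , Px))
  ... | no ¬Qx | yes (Qx , _) = ⊥-elim (¬Qx Qx)
  count-filter Q P (x ∷ L) | no ¬Px with lem {Q x × P x}
  ... | no _         = count-filter Q P L
  ... | yes (_ , Px) = ⊥-elim (¬Px Px)

  count-map : ∀ (P : Subset) (f : Carrier → Carrier) L →
              count lem P (map f L) ≡ count lem (P ∘ f) L
  count-map P f [] = refl
  count-map P f (x ∷ L) with lem {P (f x)}
  ... | yes _ = cong suc (count-map P f L)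
  ... | no _  = count-map P f L

  count-+-≤ : ∀ {P₁ P₂ Q R : Subset} → P₁ ⊆ Q ∩ R → P₂ ⊆ Q ∩ ∁ R →
              ∀ L → count lem P₁ L ℕ.+ count lem P₂ L ℕ.≤ count lem Q L
  count-+-≤ {Q = Q} {R} P₁⊆ P₂⊆ L = begin
    count lem _ L ℕ.+ count lem _ L
      ≤⟨ ℕₚ.+-mono-≤ (count-mono P₁⊆ L) (count-mono P₂⊆ L) ⟩
    count lem (Q ∩ R) L ℕ.+ count lem (Q ∩ ∁ R) L
      ≡⟨ count-split Q R L ⟨
    count lem Q L
      ∎
    where open ℕₚ.≤-Reasoning

  count-≤-+ : ∀ {P₁ P₂ Q R : Subset} → Q ∩ R ⊆ P₁ → Q ∩ ∁ R ⊆ P₂ →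
              ∀ L → count lem Q L ℕ.≤ count lem P₁ L ℕ.+ count lem P₂ L
  count-≤-+ {Q = Q} {R} ⊆P₁ ⊆P₂ L = begin
    count lem Q L
      ≡⟨ count-split Q R L ⟩
    count lem (Q ∩ R) L ℕ.+ count lem (Q ∩ ∁ R) L
      ≤⟨ ℕₚ.+-mono-≤ (count-mono ⊆P₁ L) (count-mono ⊆P₂ L) ⟩
    count lem _ L ℕ.+ count lem _ L
      ∎
    where open ℕₚ.≤-Reasoning

  ∈-filter-decide⁺ : ∀ {P} → Respects P → ∀ {x L} → x ∈L L → P x → x ∈L filter (decide P) L
  ∈-filter-decide⁺ {P} resp = ∈-filter⁺ setoid (decide P) (λ x≈y Px → resp Px x≈y)

  ∈-filter-decide⁻ : ∀ {P} → Respects P → ∀ {x L} → x ∈L filter (decide P) L → x ∈L L × P x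
  ∈-filter-decide⁻ {P} resp = ∈-filter⁻ setoid (decide P) (λ x≈y Px → resp Px x≈y)

  Maximal : Subset → List Carrier → Carrier → Set a
  Maximal P L m = P m × m ∈L L × (∀ {b} → P b → b ∈L L → ¬ m < b)

  maximal-exists : ∀ {P} → Respects P → ∀ L → (∃ λ b → P b × b ∈L L) → ∃ (Maximal P L)
  maximal-exists resp [] (_ , _ , ())
  maximal-exists {P} resp (x ∷ L) (b , Pb , b∈x∷L) with lem {∃ λ c → P c × c ∈L L}
  ... | no noneInL = x , Px , here ≈-refl , x-max
    where
    witness-is-head : b ∈L (x ∷ L) → P x
    witness-is-head (here b≈x)  = resp Pb b≈x
    witness-is-head (there b∈L) = ⊥-elim (noneInL (b , Pb , b∈L))
    Px : P x
    Px = witness-is-head b∈x∷L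
    x-max : ∀ {c} → P c → c ∈L (x ∷ L) → ¬ x < c
    x-max _  (here c≈x)    = <-irrefl (≈-sym c≈x)
    x-max Pc (there c∈L) _ = noneInL (_ , Pc , c∈L)
  ... | yes someInL with maximal-exists resp L someInL
  ...   | m , Pm , m∈L , m-max with lem {P x × m < x}
  ...     | yes (Px , m<x) = x , Px , here ≈-refl , x-max
    where
    x-max : ∀ {c} → P c → c ∈L (x ∷ L) → ¬ x < c
    x-max _  (here c≈x)      = <-irrefl (≈-sym c≈x)
    x-max Pc (there c∈L) x<c = m-max Pc c∈L (<-trans m<x x<c)
  ...     | no ¬x>m = m , Pm , there m∈L , m-max′
    where
    m-max′ : ∀ {c} → P c → c ∈L (x ∷ L) → ¬ m < c
    m-max′ Pc (here c≈x)  m<c = ¬x>m (resp Pc c≈x , <-respʳ c≈x m<c)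
    m-max′ Pc (there c∈L)     = m-max Pc c∈L

  -- 𝒥 without nonemptiness: the pieces the induction cuts J into may be empty.
  record IsDownSet (J : List Carrier) : Set a where
    field
      distinct   : AllPairs (λ x y → ¬ (x ≈ y)) J
      positive   : ∀ {x} → x ∈L J → ε < x
      downClosed : ∀ {x y} → x ∈L J → ε < y → y < x → y ∈L J

  InJ⇒IsDownSet : ∀ {J} → InJ J → IsDownSet J
  InJ⇒IsDownSet inJ = record { InJ inJ }

  lowerDensity-downSet : ∀ {β B J} → LowerDensity lem β B → IsDownSet J →
                         β * size J ℚ.≤ ι (count lem B J)
  lowerDensity-downSet {β} {J = []}    _       _    = *ι-zero≤ι β 0
  lowerDensity-downSet {J = x ∷ J} density down =
    density (x ∷ J) record { IsDownSet down ; nonempty = λ () }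

  filter-downSet : ∀ {J} (P : Subset) → Respects P → IsDownSet J →
                   (∀ {x y} → x ∈L J → P x → ε < y → y < x → P y) →
                   IsDownSet (filter (decide P) J)
  filter-downSet {J} P resp J-down P-down = record
    { distinct   = Unique.filter⁺ setoid (decide P) distinct
    ; positive   = positive ∘ proj₁ ∘ ∈-filter-decide⁻ resp
    ; downClosed = downClosed′
    }
    where
    open IsDownSet J-down
    downClosed′ : ∀ {x y} → x ∈L filter (decide P) J → ε < y → y < x → y ∈L filter (decide P) J
    downClosed′ x∈ ε<y y<x with ∈-filter-decide⁻ resp x∈
    ... | x∈J , Px = ∈-filter-decide⁺ resp (downClosed x∈J ε<y y<x) (P-down x∈J Px ε<y y<x)

  shift-downSet : ∀ {m L} → AllPairs (λ x y → ¬ (x ≈ y)) L → (∀ {y} → y ∈L L → m < y) →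
                  (∀ {y z} → y ∈L L → m < z → z < y → z ∈L L) →
                  IsDownSet (map (m \\_) L)
  shift-downSet {m} {L} distinct above interval = record
    { distinct   = Unique.map⁺ setoid setoid (λ {x} {y} → ∙-cancelˡ (m ⁻¹) x y) distinct
    ; positive   = positive
    ; downClosed = downClosed
    }
    where
    positive : ∀ {y} → y ∈L map (m \\_) L → ε < y
    positive y∈ with ∈-map⁻ setoid setoid y∈
    ... | x , x∈L , y≈m\\x = <-respʳ (≈-sym y≈m\\x) (<⇒ε<\\ (above x∈L))
    downClosed : ∀ {y z} → y ∈L map (m \\_) L → ε < z → z < y → z ∈L map (m \\_) L
    downClosed {z = z} y∈ ε<z z<y with ∈-map⁻ setoid setoid y∈
    ... | x , x∈L , y≈m\\x =
      ∈-resp-≈ setoid (\\-leftDividesʳ m z) (∈-map⁺ setoid setoid ∙-congˡ mz∈L)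
      where
      mz<x : (m ∙ z) < x
      mz<x = <-respʳ (≈-trans (∙-congˡ y≈m\\x) (\\-leftDividesˡ m x)) (<-compatˡ m z<y)
      mz∈L : (m ∙ z) ∈L L
      mz∈L = interval x∈L (ε<⇒<∙ ε<z) mz<x

  StarNonempty : Subset → List Carrier → Set a
  StarNonempty A J = ∀ {x} → x ∈L J → ¬ A x → ∃ λ b → A b × b < x

  module Gap {A : Subset} (A-resp : Respects A) (A-pos : ∀ {x} → A x → ε < x) where

    module Decomposition {J} (J-down : IsDownSet J) {m} (m-max : Maximal A J m) where
      open IsDownSet J-down

      Am : A m
      Am = proj₁ m-max

      m∈J : m ∈L J
      m∈J = proj₁ (proj₂ m-max)

      above-m-∉A : ∀ {y} → y ∈L J → m < y → ¬ A y
      above-m-∉A y∈J m<y Ay = proj₂ (proj₂ m-max) Ay y∈J m<y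

      Above : Subset
      Above y = m < y × ¬ A y

      Rest : Subset
      Rest y = ¬ (y ≈ m) × ¬ Above y

      Above-resp : Respects Above
      Above-resp (m<y , ¬Ay) y≈z = <-respʳ y≈z m<y , λ Az → ¬Ay (A-resp Az (≈-sym y≈z))

      Rest-resp : Respects Rest
      Rest-resp (y≉m , ¬Above-y) y≈z =
        (λ z≈m → y≉m (≈-trans y≈z z≈m)) , (λ Above-z → ¬Above-y (Above-resp Above-z (≈-sym y≈z)))

      above gap rest : List Carrier
      above = filter (decide Above) J
      gap   = map (m \\_) above
      rest  = filter (decide Rest) J

      rest⊆J : ∀ {x} → x ∈L rest → x ∈L J
      rest⊆J = proj₁ ∘ ∈-filter-decide⁻ Rest-resp

      rest-downSet : IsDownSet rest
      rest-downSet = filter-downSet Rest Rest-resp J-down Rest-down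
        where
        Rest-down : ∀ {x y} → x ∈L J → Rest x → ε < y → y < x → Rest y
        Rest-down {x} x∈J (_ , ¬Above-x) _ y<x =
          (λ y≈m → m≮x (<-respˡ y≈m y<x)) , (λ (m<y , _) → m≮x (<-trans m<y y<x))
          where
          m≮x : ¬ m < x
          m≮x m<x = ¬Above-x (m<x , above-m-∉A x∈J m<x)

      rest-shorter : length rest ℕ.< length J
      rest-shorter =
        Listₚ.filter-notAll (decide Rest) J (Any.map (λ m≈y Rest-y → proj₁ Rest-y (≈-sym m≈y)) m∈J)

      gap-downSet : IsDownSet gap
      gap-downSet = shift-downSet (Unique.filter⁺ setoid (decide Above) distinct)
                                  (proj₁ ∘ proj₂ ∘ ∈-filter-decide⁻ Above-resp {L = J}) interval
        where
        interval : ∀ {y z} → y ∈L above → m < z → z < y → z ∈L above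
        interval y∈ m<z z<y = ∈-filter-decide⁺ Above-resp z∈J (m<z , above-m-∉A z∈J m<z)
          where
          z∈J = downClosed (proj₁ (∈-filter-decide⁻ Above-resp y∈)) (<-trans (positive m∈J) m<z) z<y

      count-∉A-≤ : count lem (∁ A) J ℕ.≤ length gap ℕ.+ count lem (∁ A) rest
      count-∉A-≤ = subst₂ (λ k l → count lem (∁ A) J ℕ.≤ k ℕ.+ l)
        (sym (trans (Listₚ.length-map (m \\_) above) (length-filter≡count Above J)))
        (sym (count-filter (∁ A) Rest J))
        (count-≤-+ proj₂ (λ (¬Ay , ¬Above-y) → ¬Ay , (λ y≈m → ¬Ay (A-resp Am (≈-sym y≈m))) , ¬Above-y) J)

      count-gap-≤ : ∀ B → count lem B gap ℕ.+ count lem ((A · B) ∩ ∁ A) rest ℕ.≤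
                          count lem ((A · B) ∩ ∁ A) J
      count-gap-≤ B = subst₂ (λ k l → k ℕ.+ l ℕ.≤ count lem ((A · B) ∩ ∁ A) J)
        (sym (trans (count-map B (m \\_) above) (count-filter (B ∘ (m \\_)) Above J)))
        (sym (count-filter ((A · B) ∩ ∁ A) Rest J))
        (count-+-≤ m·B⊆ (λ (AB∖A-y , Rest-y) → AB∖A-y , proj₂ Rest-y) J)
        where
        m·B⊆ : (B ∘ (m \\_)) ∩ Above ⊆ ((A · B) ∩ ∁ A) ∩ Above
        m·B⊆ {y} (B[m\\y] , m<y , ¬Ay) =
          ((m , m \\ y , Am , B[m\\y] , ≈-sym (\\-leftDividesˡ m y)) , ¬Ay) , m<y , ¬Ay

    gap-bound : ∀ {β} (B : Subset) → LowerDensity lem β B →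
                ∀ {J} → IsDownSet J → StarNonempty A J →
                β * ι (count lem (∁ A) J) ℚ.≤ ι (count lem ((A · B) ∩ ∁ A) J)
    gap-bound {β} B density {J} with ℚₚ.≤-total β 0ℚ
    ... | inj₁ β≤0 = λ _ _ → nonPos*ι≤ι (count lem (∁ A) J) (count lem ((A · B) ∩ ∁ A) J) β≤0
    ... | inj₂ 0≤β = go J (On.wellFounded length <-wellFounded J)
      where
      go : ∀ J → Acc (ℕ._<_ on length) J → IsDownSet J → StarNonempty A J →
           β * ι (count lem (∁ A) J) ℚ.≤ ι (count lem ((A · B) ∩ ∁ A) J)
      go J (acc smaller) J-down star with lem {∃ λ x → x ∈L J × ¬ A x}
      ... | no J⊆A = subst (λ n → β * ι n ℚ.≤ ι (count lem ((A · B) ∩ ∁ A) J))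
                       (sym (count-none (∁ A) J (λ x∈J ¬Ax → J⊆A (_ , x∈J , ¬Ax))))
                       (*ι-zero≤ι β (count lem ((A · B) ∩ ∁ A) J))
      ... | yes (x , x∈J , ¬Ax) with star x∈J ¬Ax
      ...   | b , Ab , b<x with maximal-exists A-resp J (b , Ab , b∈J)
        where b∈J = IsDownSet.downClosed J-down x∈J (A-pos Ab) b<x
      ...     | m , m-max =
        *ι-split {d = length gap} {k₁ = count lem B gap} 0≤β count-∉A-≤
          (lowerDensity-downSet {β} {B} density gap-downSet)
          (go rest (smaller rest-shorter) rest-downSet (star ∘ rest⊆J))
          (count-gap-≤ B)
        where open Decomposition J-down m-max

  prodG-ε : ∀ n → prodG n (λ _ → ε) ≈ ε
  prodG-ε zero    = ≈-refl
  prodG-ε (suc n) = ≈-trans (identityˡ _) (prodG-ε n)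

  head⊆ProdSet : ∀ {h} (A : Fin (suc h) → Subset) → A zero ⊆ ProdSet (suc h) A
  head⊆ProdSet {h} A {x} Ax = (λ { zero → x ; (suc i) → ε })
                            , (λ { zero → inj₁ Ax ; (suc i) → inj₂ ≈-refl })
                            , ≈-trans (≈-sym (identityʳ x)) (∙-congˡ (≈-sym (prodG-ε h)))

  ·⊆ProdSet : ∀ {h} (A : Fin (suc h) → Subset) →
              (A zero · ProdSet h (A ∘ suc)) ⊆ ProdSet (suc h) A
  ·⊆ProdSet A (u , v , Au , (f , f∈A , v≈∏f) , x≈uv) = (λ { zero → u ; (suc i) → f i })
                                                  , (λ { zero → inj₁ Au ; (suc i) → f∈A i })
                                                  , ≈-trans x≈uv (∙-congˡ v≈∏f)

  length-positive : ∀ {J} → InJ J → 0 ℕ.< length J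
  length-positive {[]}    inJ = ⊥-elim (InJ.nonempty inJ refl)
  length-positive {_ ∷ _} _   = s≤s z≤n

  product-density : ∀ h (A : Fin h → Subset) → (∀ i → Respects (A i)) →
                    (∀ i {x} → A i x → ε < x) → (∀ i J → InJ J → StarNonempty (A i) J) →
                    (q : Fin h → ℚ) → (∀ i → LowerDensity lem (q i) (A i)) →
                    LowerDensity lem (1ℚ - prodℚ h (λ i → 1ℚ - q i)) (ProdSet h A)
  product-density zero A _ _ _ _ _ J inJ =
    nonPos*ι≤ι (length J) (count lem (ProdSet zero A) J) (ℚₚ.≤-reflexive (ℚₚ.+-inverseʳ 1ℚ))
  product-density (suc h) A A-resp A-pos star q density J inJ = ℚₚ.≤-trans
    (density-combine {q zero} {P} {length J} {count lem (A zero) J} {count lem (∁ (A zero)) J}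
       P≥0 (sym (count-complement (A zero) J)) (density zero J inJ) gap)
    (ι-mono (count-+-≤ (λ Ax → head⊆ProdSet A Ax , Ax) (λ (ABx , ¬Ax) → ·⊆ProdSet A ABx , ¬Ax) J))
    where
    B = ProdSet h (A ∘ suc)
    P = prodℚ h (λ i → 1ℚ - q (suc i))
    B-density : LowerDensity lem (1ℚ - P) B
    B-density = product-density h (A ∘ suc) (A-resp ∘ suc) (λ i → A-pos (suc i))
                                (star ∘ suc) (q ∘ suc) (density ∘ suc)
    P≥0 : 0ℚ ℚ.≤ P
    P≥0 = [1-p]n≤m≤n⇒0≤p (count lem B J) (length J) (length-positive inJ)
                         (B-density J inJ) (count-≤-length B J)
    gap : (1ℚ - P) * ι (count lem (∁ (A zero)) J) ℚ.≤ ι (count lem ((A zero · B) ∩ ∁ (A zero)) J)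
    gap = Gap.gap-bound (A-resp zero) (A-pos zero) {1ℚ - P} B B-density
                        (InJ⇒IsDownSet inJ) (star zero J inJ)

theorem3p3 : ∀ {a : Level} (lem : ExcludedMiddle a)
  (G : Group a a) (_≼_ : Rel (Group.Carrier G) a) → IsPOGroup G _≼_ →
  let open Group G using (ε)
      open POGroup G _≼_
  in (h : ℕ) → 2 ≤ h → (A : Fin h → Subset) →
     (∀ i → Respects (A i)) →
     (∀ i {x} → A i x → ε < x) →
     (∀ J → InJ J → ∀ i {x} → x ∈L J → ¬ A i x → StarNonemptyFinite (A i) x) →
     (q : Fin h → ℚ) → (∀ i → LowerDensity lem (q i) (A i)) →
     LowerDensity lem (1ℚ - prodℚ h (λ i → 1ℚ - q i)) (ProdSet h A)
theorem3p3 lem G _≼_ po h _ A A-resp A-pos star =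
  product-density lem G _≼_ po h A A-resp A-pos
    (λ i J inJ x∈J ¬Ax → proj₁ (star J inJ i x∈J ¬Ax))
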